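{- Let $s,t \geq 1$ be integers and let $\beta_{s,t}$ be the type-$\beta$ comb with $s$ teeth of length $t$. Then the number of linear extensions of $\beta_{s,t}$ that avoid the pattern $231$ equals $t^{s-1}$.
   Context: A linear extension of a finite poset $P$ on a set of integers is a listing $v=[v_1,\dots,v_n]$ of all elements of $P$, each exactly once, such that whenever $a \leq_P b$, $a$ appears before $b$. For $w \in S_3$, a sequence $v$ of distinct integers contains $w$ if there are indices $i<j<k$ with $(v_i,v_j,v_k)$ in the same relative order as $(w_1,w_2,w_3)$; otherwise $v$ avoids $w$. The type-$\beta$ comb $\beta_{s,t}$ is the poset on $\{1,\dots,st\}$ whose order is generated by the relations $ct+1 \leq (c+1)t+1$ for $0 \leq c \leq s-2$ (the spine) and $ct+j \leq ct+j+1$ for $0 \leq c \leq s-1$, $1 \leq j \leq t-1$ (the teeth $\{ct+1,\dots,ct+t\}$). -}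

module Defs where

open import Data.Nat using (ℕ; zero; suc; _+_; _*_; _≤_; _<_)
open import Data.Fin using (Fin; toℕ)
open import Data.List using (List; length; lookup; upTo; map)
open import Data.List.Relation.Binary.Permutation.Propositional using (_↭_)
open import Data.Product using (∃; _×_; Σ-syntax)
open import Relation.Nullary using (¬_)
open import Relation.Binary.Construct.Closure.ReflexiveTransitive using (Star)

range1 : ℕ → List ℕ
range1 n = map suc (upTo n)

data BetaGen (s t : ℕ) : ℕ → ℕ → Set where
  spine : (c : ℕ) → suc c < s →
          BetaGen s t (c * t + 1) (suc c * t + 1)
  tooth : (c j : ℕ) → c < s → 1 ≤ j → suc j ≤ t →
          BetaGen s t (c * t + j) (c * t + suc j)

_≤β[_,_]_ : ℕ → ℕ → ℕ → ℕ → Set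
a ≤β[ s , t ] b = Star (BetaGen s t) a b

IsLinearExtension : ℕ → ℕ → List ℕ → Set
IsLinearExtension s t v =
  (v ↭ range1 (s * t)) ×
  (∀ (i j : Fin (length v)) →
     lookup v i ≤β[ s , t ] lookup v j → toℕ i ≤ toℕ j)

Contains231 : List ℕ → Set
Contains231 v = ∃ λ (i : Fin (length v)) → ∃ λ (j : Fin (length v)) →
  ∃ λ (k : Fin (length v)) →
    (toℕ i < toℕ j) × (toℕ j < toℕ k) ×
    (lookup v k < lookup v i) × (lookup v i < lookup v j)

Avoids231 : List ℕ → Set
Avoids231 v = ¬ Contains231 v

-- Consider a 231-avoiding linear extension of β_{s,t}.  Before the spine element h of tooth c+1 only
-- elements of teeth ≤ c can appear.  Once h has appeared, the elements of tooth c not yet listed (all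
-- below h) must follow it at once: an element of a later tooth (all above h) placed before one of them
-- would form a 231 with h.  Reading the teeth in order, the extension is therefore determined by how many
-- of the t-1 non-spine elements of tooth c precede h, for each of the first s-1 teeth, and each of these
-- t^(s-1) choices does give a 231-avoiding linear extension.

module Submission where

open import Data.Fin using (Fin; toℕ; fromℕ<) renaming (zero to fzero; suc to fsuc)
open import Data.Fin.Properties using (toℕ-injective; toℕ<n; toℕ-fromℕ<)
open import Data.List
  using (List; []; _∷_; _++_; length; lookup; map; applyUpTo; take; drop; cartesianProductWith; allFin)
open import Data.List.Properties
  using (length-++; length-map; length-tabulate; ∷-injectiveˡ; ∷-injectiveʳ; ++-cancelˡ; ++-identityʳ; ++-assoc;
         take++drop≡id)
open import Data.List.Membership.Propositional using (_∈_; _∉_)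
open import Data.List.Membership.Propositional.Properties
  using (∈-++⁻; ∈-++⁺ʳ; ∈-lookup; ∈-cartesianProductWith⁻; ∈-cartesianProductWith⁺; ∈-allFin; ∈-map⁻; ∈-map⁺)
open import Data.List.Relation.Binary.Permutation.Propositional
  using (_↭_; ↭-sym; ↭-trans; ↭-reflexive; prep; module PermutationReasoning)
open import Data.List.Relation.Binary.Permutation.Propositional.Properties
  using (∈-resp-↭; drop-∷; shift; ¬x∷xs↭[]; ↭-empty-inv; All-resp-↭; ++⁺ˡ)
open import Data.List.Relation.Unary.All as All using (All; []; _∷_)
import Data.List.Relation.Unary.All.Properties as All
open import Data.List.Relation.Unary.AllPairs as AllPairs using (AllPairs; []; _∷_)
import Data.List.Relation.Unary.AllPairs.Properties as AllPairs
open import Data.List.Relation.Unary.Any using (here; there; index)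
open import Data.List.Relation.Unary.Any.Properties using (lookup-index)
open import Data.List.Relation.Unary.Linked as Linked using (Linked; []; [-]; _∷_)
open import Data.List.Relation.Unary.Linked.Properties using (Linked⇒AllPairs)
open import Data.List.Relation.Unary.Unique.Propositional using (Unique)
import Data.List.Relation.Unary.Unique.Propositional.Properties as Unique
open import Data.Nat using (ℕ; zero; suc; _+_; _*_; _^_; _∸_; _≤_; _<_; z≤n; s≤s; s≤s⁻¹; z<s; s<s; _≟_)
open import Data.Nat.Properties
open import Data.Product using (∃; ∃₂; _×_; _,_)
open import Data.Sum using (_⊎_; inj₁; inj₂)
open import Function using (id; _∘_)
open import Function.Bundles using (_⇔_; mk⇔; Equivalence)
open import Relation.Binary.Construct.Closure.ReflexiveTransitive using (ε; _◅_; _◅◅_)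
open import Relation.Binary.Definitions using (DecidableEquality)
open import Relation.Binary.PropositionalEquality
open import Relation.Nullary using (¬_; yes; no; contradiction)

open import Defs using (range1; BetaGen; spine; tooth; _≤β[_,_]_; IsLinearExtension; Avoids231)

-- The offset j is kept apart from the base a so that entries have the shape c * t + j of the comb's
-- generators.
interval : ℕ → ℕ → ℕ → List ℕ
interval a j zero    = []
interval a j (suc n) = a + j ∷ interval a (suc j) n

length-interval : ∀ a j n → length (interval a j n) ≡ n
length-interval a j zero    = refl
length-interval a j (suc n) = cong suc (length-interval a (suc j) n)

interval⁺ : ∀ {P : ℕ → Set} a j n → (∀ k → k < n → P (a + (j + k))) → All P (interval a j n)
interval⁺ {P} a j zero    f = []
interval⁺ {P} a j (suc n) f =
  subst P (cong (a +_) (+-identityʳ j)) (f 0 z<s) ∷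
  interval⁺ a (suc j) n (λ k k<n → subst P (cong (a +_) (+-suc j k)) (f (suc k) (s<s k<n)))

interval-cong : ∀ {a j a′ j′} n → a + j ≡ a′ + j′ → interval a j n ≡ interval a′ j′ n
interval-cong zero eq = refl
interval-cong {a} {j} {a′} {j′} (suc n) eq =
  cong₂ _∷_ eq (interval-cong n (trans (+-suc a j) (trans (cong suc eq) (sym (+-suc a′ j′)))))

interval-++ : ∀ a j m n → interval a j (m + n) ≡ interval a j m ++ interval a (j + m) n
interval-++ a j zero    n = interval-cong n (cong (a +_) (sym (+-identityʳ j)))
interval-++ a j (suc m) n =
  cong (a + j ∷_) (trans (interval-++ a (suc j) m n)
                         (cong (interval a (suc j) m ++_) (interval-cong n (cong (a +_) (sym (+-suc j m))))))

range1≡interval : ∀ n → range1 n ≡ interval 0 1 n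
range1≡interval n = go n id 0 (λ _ → refl)
  where
  go : ∀ n (f : ℕ → ℕ) j → (∀ k → f k ≡ j + k) → map suc (applyUpTo f n) ≡ interval 0 (suc j) n
  go zero    f j _  = refl
  go (suc n) f j fk = cong₂ _∷_ (cong suc (trans (fk 0) (+-identityʳ j)))
                                (go n (f ∘ suc) (suc j) (λ k → trans (fk (suc k)) (+-suc j k)))

interval-increasing : ∀ a j n → AllPairs _<_ (interval a j n)
interval-increasing a j zero    = []
interval-increasing a j (suc n) =
  interval⁺ a (suc j) n (λ k _ → +-monoʳ-< a (s≤s (m≤m+n j k))) ∷ interval-increasing a (suc j) n

length-cartesianProductWith : ∀ {A B C : Set} (f : A → B → C) xs ys →
  length (cartesianProductWith f xs ys) ≡ length xs * length ys
length-cartesianProductWith f []       ys = refl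
length-cartesianProductWith f (x ∷ xs) ys = begin
  length (map (f x) ys ++ cartesianProductWith f xs ys)
    ≡⟨ length-++ (map (f x) ys) ⟩
  length (map (f x) ys) + length (cartesianProductWith f xs ys)
    ≡⟨ cong₂ _+_ (length-map (f x) ys) (length-cartesianProductWith f xs ys) ⟩
  length ys + length xs * length ys
    ∎
  where open ≡-Reasoning

module _ {A : Set} {R : A → A → Set} where

  AllPairs-lookup : ∀ {xs} → AllPairs R xs → ∀ (i j : Fin (length xs)) → toℕ i < toℕ j →
                    R (lookup xs i) (lookup xs j)
  AllPairs-lookup (rx ∷ _)   fzero    (fsuc j) _   = All.lookup rx (∈-lookup j)
  AllPairs-lookup (_  ∷ rxs) (fsuc i) (fsuc j) i<j = AllPairs-lookup rxs i j (s≤s⁻¹ i<j)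

  lookup⇒AllPairs : ∀ xs → (∀ (i j : Fin (length xs)) → toℕ i < toℕ j → R (lookup xs i) (lookup xs j)) →
                    AllPairs R xs
  lookup⇒AllPairs []       _       = []
  lookup⇒AllPairs (x ∷ xs) related =
    All.tabulate (λ y∈xs → subst (R x) (sym (lookup-index y∈xs)) (related fzero (fsuc (index y∈xs)) z<s)) ∷
    lookup⇒AllPairs xs (λ i j i<j → related (fsuc i) (fsuc j) (s<s i<j))

  AllPairs-++⁻ʳ : ∀ xs {ys} → AllPairs R (xs ++ ys) → AllPairs R ys
  AllPairs-++⁻ʳ []       rys        = rys
  AllPairs-++⁻ʳ (x ∷ xs) (_ ∷ rxys) = AllPairs-++⁻ʳ xs rxys

∈-tail : ∀ {A : Set} {x z : A} {xs ys} → x ∷ xs ↭ ys → z ∈ ys → z ≢ x → z ∈ xs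
∈-tail p z∈ys z≢x with ∈-resp-↭ (↭-sym p) z∈ys
... | here z≡x   = contradiction z≡x z≢x
... | there z∈xs = z∈xs

module _ {A : Set} {R : A → A → Set} where

  RespectsOrder : List A → Set
  RespectsOrder = AllPairs (λ x y → ¬ R y x)

  respectsOrder⇔lookup : ∀ v → RespectsOrder v ⇔
    (∀ (i j : Fin (length v)) → R (lookup v i) (lookup v j) → toℕ i ≤ toℕ j)
  respectsOrder⇔lookup v = mk⇔
    (λ resp i j r → ≮⇒≥ (λ j<i → AllPairs-lookup resp j i j<i r))
    (λ ordered → lookup⇒AllPairs v (λ i j i<j r → <⇒≱ i<j (ordered j i r)))

  module _ (_≟_ : DecidableEquality A) where

    chain-prefix : ∀ C {Ys} X → RespectsOrder X → X ↭ C ++ Ys →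
                   AllPairs R C → All (λ c → All (R c) Ys) C →
                   ∃ λ T → X ≡ C ++ T × T ↭ Ys
    chain-prefix []      X       _           p _             _             = X , refl , p
    chain-prefix (c ∷ C) []      _           p _             _             = contradiction (↭-sym p) ¬x∷xs↭[]
    chain-prefix (c ∷ C) (y ∷ X) (y↛ ∷ resp) p (c≤C ∷ chain) (c≤Ys ∷ C≤Ys) with y ≟ c
    ... | yes refl = let T , X≡ , q = chain-prefix C X resp (drop-∷ p) chain C≤Ys
                     in  T , cong (y ∷_) X≡ , q
    ... | no y≢c   = contradiction (All.lookup (All.++⁺ c≤C c≤Ys) (∈-tail (↭-sym p) (here refl) y≢c))
                                   (All.lookup y↛ (∈-tail p (here refl) (y≢c ∘ sym)))

    pivot-split : ∀ C {h Ys} X → RespectsOrder X → X ↭ C ++ h ∷ Ys → AllPairs R C → All (R h) Ys →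
                  ∃₂ λ q T → q ≤ length C × X ≡ take q C ++ h ∷ T × T ↭ drop q C ++ Ys
    pivot-split []      []      _           p _             _    = contradiction (↭-sym p) ¬x∷xs↭[]
    pivot-split (_ ∷ _) []      _           p _             _    = contradiction (↭-sym p) ¬x∷xs↭[]
    pivot-split [] {h}  (y ∷ X) (y↛ ∷ _)    p _             h≤Ys with y ≟ h
    ... | yes refl = 0 , X , z≤n , refl , drop-∷ p
    ... | no y≢h   = contradiction (All.lookup h≤Ys (∈-tail (↭-sym p) (here refl) y≢h))
                                   (All.lookup y↛ (∈-tail p (here refl) (y≢h ∘ sym)))
    pivot-split (c ∷ C) {h} {Ys} (y ∷ X) (y↛ ∷ resp) p (c≤C ∷ chain) h≤Ys with y ≟ c | y ≟ h
    ... | yes refl | _        = let q , T , q≤ , X≡ , T↭ = pivot-split C X resp (drop-∷ p) chain h≤Ys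
                                in  suc q , T , s≤s q≤ , cong (y ∷_) X≡ , T↭
    ... | no _     | yes refl = 0 , X , z≤n , refl , drop-∷ (↭-trans p (shift y (c ∷ C) Ys))
    ... | no y≢c   | no y≢h   with ∈-++⁻ C (∈-tail (↭-sym p) (here refl) y≢c)
    ...   | inj₁ y∈C          = contradiction (All.lookup c≤C y∈C)
                                  (All.lookup y↛ (∈-tail p (here refl) (y≢c ∘ sym)))
    ...   | inj₂ (here y≡h)   = contradiction y≡h y≢h
    ...   | inj₂ (there y∈Ys) = contradiction (All.lookup h≤Ys y∈Ys)
                                  (All.lookup y↛ (∈-tail p (∈-++⁺ʳ (c ∷ C) (here refl)) (y≢h ∘ sym)))


infix 4 _≪_
_≪_ : List ℕ → List ℕ → Set
xs ≪ ys = All (λ x → All (x <_) ys) xs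

≪-separated : ∀ {h xs ys} → All (_< h) xs → All (h ≤_) ys → xs ≪ ys
≪-separated xs<h h≤ys = All.map (λ x<h → All.map (<-≤-trans x<h) h≤ys) xs<h

take≪drop : ∀ n {xs} → AllPairs _<_ xs → take n xs ≪ drop n xs
take≪drop zero    _               = []
take≪drop (suc n) []              = []
take≪drop (suc n) (x<xs ∷ sorted) = All.drop⁺ n x<xs ∷ take≪drop n sorted

respectsOrder-++ : ∀ {R : ℕ → ℕ → Set} {xs ys} → (∀ {x y} → R x y → x ≤ y) →
                   AllPairs _<_ xs → xs ≪ ys → RespectsOrder {R = R} ys →
                   RespectsOrder {R = R} (xs ++ ys)
respectsOrder-++ {R} R⇒≤ sorted below resp =
  AllPairs.++⁺ (AllPairs.map ≯ sorted) resp (All.map (All.map ≯) below)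
  where
  ≯ : ∀ {x y} → x < y → ¬ R y x
  ≯ x<y r = <⇒≱ x<y (R⇒≤ r)

-- x cannot be the 2 of a 231 whose 3 and 1 lie in the list.
NoDropBelow : ℕ → List ℕ → Set
NoDropBelow x = AllPairs (λ y z → x < y → x ≤ z)

data Avoids231′ : List ℕ → Set where
  []  : Avoids231′ []
  _∷_ : ∀ {x xs} → NoDropBelow x xs → Avoids231′ xs → Avoids231′ (x ∷ xs)

avoids231′⇔avoids231 : ∀ v → Avoids231′ v ⇔ Avoids231 v
avoids231′⇔avoids231 v = mk⇔ avoids231′⇒avoids231 (avoids231⇒avoids231′ v)
  where
  avoids231′⇒avoids231 : ∀ {v} → Avoids231′ v → Avoids231 v
  avoids231′⇒avoids231 (nd ∷ _) (fzero , fsuc j , fsuc k , _ , j<k , vk<x , x<vj) =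
    <⇒≱ vk<x (AllPairs-lookup nd j k (s≤s⁻¹ j<k) x<vj)
  avoids231′⇒avoids231 (_ ∷ av) (fsuc i , fsuc j , fsuc k , i<j , j<k , vk<vi , vi<vj) =
    avoids231′⇒avoids231 av (i , j , k , s≤s⁻¹ i<j , s≤s⁻¹ j<k , vk<vi , vi<vj)

  avoids231⇒avoids231′ : ∀ v → Avoids231 v → Avoids231′ v
  avoids231⇒avoids231′ []      _     = []
  avoids231⇒avoids231′ (x ∷ v) avoid =
    lookup⇒AllPairs v (λ j k j<k x<vj →
      ≮⇒≥ (λ vk<x → avoid (fzero , fsuc j , fsuc k , z<s , s<s j<k , vk<x , x<vj))) ∷
    avoids231⇒avoids231′ v (λ { (i , j , k , i<j , j<k , vk<vi , vi<vj) →
                                avoid (fsuc i , fsuc j , fsuc k , s<s i<j , s<s j<k , vk<vi , vi<vj) })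

avoids231′-++⁻ʳ : ∀ xs {ys} → Avoids231′ (xs ++ ys) → Avoids231′ ys
avoids231′-++⁻ʳ []       av       = av
avoids231′-++⁻ʳ (x ∷ xs) (_ ∷ av) = avoids231′-++⁻ʳ xs av

noDropBelow-least : ∀ {x zs} → All (x ≤_) zs → NoDropBelow x zs
noDropBelow-least []          = []
noDropBelow-least (_ ∷ x≤zs) = All.map (λ x≤z _ → x≤z) x≤zs ∷ noDropBelow-least x≤zs

noDropBelow-pivot : ∀ {h B T} → All (_< h) B → All (h ≤_) T → NoDropBelow h (B ++ T)
noDropBelow-pivot []          h≤T = noDropBelow-least h≤T
noDropBelow-pivot (b<h ∷ B<h) h≤T =
  All.tabulate (λ _ h<b → contradiction h<b (<-asym b<h)) ∷ noDropBelow-pivot B<h h≤T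

avoids231′-++ : ∀ {xs ys} → AllPairs _<_ xs → xs ≪ ys → Avoids231′ ys → Avoids231′ (xs ++ ys)
avoids231′-++ []               []            av = av
avoids231′-++ (x<xs ∷ sorted) (x<ys ∷ below) av =
  noDropBelow-least (All.map <⇒≤ (All.++⁺ x<xs x<ys)) ∷ avoids231′-++ sorted below av

take-∷-injective : ∀ {A : Set} {x : A} xs {i j u v} → x ∉ xs → i ≤ length xs → j ≤ length xs →
                   take i xs ++ x ∷ u ≡ take j xs ++ x ∷ v → i ≡ j × u ≡ v
take-∷-injective xs       {zero}  {zero}  _  _       _       eq = refl , ∷-injectiveʳ eq
take-∷-injective (y ∷ xs) {zero}  {suc j} x∉ _       _       eq = contradiction (here (∷-injectiveˡ eq)) x∉
take-∷-injective (y ∷ xs) {suc i} {zero}  x∉ _       _       eq = contradiction (here (sym (∷-injectiveˡ eq))) x∉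
take-∷-injective (y ∷ xs) {suc i} {suc j} x∉ (s≤s i≤) (s≤s j≤) eq =
  let i≡j , u≡v = take-∷-injective xs (x∉ ∘ there) i≤ j≤ (∷-injectiveʳ eq) in cong suc i≡j , u≡v

module Comb (s′ t′ : ℕ) where

  s t : ℕ
  s = suc s′
  t = suc t′

  _≤β_ : ℕ → ℕ → Set
  x ≤β y = x ≤β[ s , t ] y

  -- Teeth are numbered from 0: tooth c is block c, with spine element base c; blocks c m lists the teeth
  -- c, …, c+m-1, and above c m is blocks c (suc m) without base c.
  base : ℕ → ℕ
  base c = c * t + 1

  block blockTail : ℕ → List ℕ
  block     c = interval (c * t) 1 t
  blockTail c = interval (c * t) 2 t′

  blocks above : ℕ → ℕ → List ℕ
  blocks c m = interval (c * t) 1 (m * t)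
  above  c m = interval (c * t) 2 (t′ + m * t)

  Valid : List ℕ → Set
  Valid X = RespectsOrder {R = _≤β_} X × Avoids231′ X

  ≤β⇒≤ : ∀ {x y} → x ≤β y → x ≤ y
  ≤β⇒≤ ε       = ≤-refl
  ≤β⇒≤ (g ◅ r) = ≤-trans (generator⇒≤ g) (≤β⇒≤ r)
    where
    generator⇒≤ : ∀ {x y} → BetaGen s t x y → x ≤ y
    generator⇒≤ (spine c _)       = +-monoˡ-≤ 1 (m≤n+m (c * t) t)
    generator⇒≤ (tooth c j _ _ _) = +-monoʳ-≤ (c * t) (n≤1+n j)

  block<base-suc : ∀ c {j} → j ≤ t → c * t + j < base (suc c)
  block<base-suc c j≤t =
    ≤-trans (s≤s (≤-trans (+-monoʳ-≤ (c * t) j≤t) (≤-reflexive (+-comm (c * t) t))))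
            (≤-reflexive (+-comm 1 (t + c * t)))

  blockTail<base-suc : ∀ c → All (_< base (suc c)) (blockTail c)
  blockTail<base-suc c = interval⁺ (c * t) 2 t′ (λ k k<t′ → block<base-suc c (s≤s k<t′))

  base<above : ∀ c m → All (base c <_) (above c m)
  base<above c m = interval⁺ (c * t) 2 (t′ + m * t) (λ k _ → +-monoʳ-< (c * t) (s≤s (s≤s z≤n)))

  above-++ : ∀ c m → above c m ≡ blockTail c ++ blocks (suc c) m
  above-++ c m = trans (interval-++ (c * t) 2 t′ (m * t))
                       (cong (blockTail c ++_) (interval-cong (m * t) blockTail-end))
    where
    blockTail-end : c * t + suc t ≡ suc c * t + 1
    blockTail-end = trans (+-suc (c * t) t) (trans (cong suc (+-comm (c * t) t)) (+-comm 1 (t + c * t)))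

  block-linked : ∀ c → c < s → ∀ j n → 1 ≤ j → j + n ≡ suc t → Linked (BetaGen s t) (interval (c * t) j n)
  block-linked c c<s j zero          _   _   = []
  block-linked c c<s j (suc zero)    _   _   = [-]
  block-linked c c<s j (suc (suc n)) 1≤j end =
    tooth c j c<s 1≤j sj≤t ∷ block-linked c c<s (suc j) (suc n) (s≤s z≤n) end′
    where
    end′ : suc j + suc n ≡ suc t
    end′ = trans (sym (+-suc j (suc n))) end
    sj≤t : suc j ≤ t
    sj≤t = ≤-trans (m≤m+n (suc j) n) (≤-reflexive (suc-injective (trans (sym (+-suc (suc j) n)) end′)))

  block-chain : ∀ c → c < s → AllPairs _≤β_ (block c)
  block-chain c c<s = Linked⇒AllPairs _◅◅_ (Linked.map (_◅ ε) (block-linked c c<s 1 t ≤-refl refl))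

  <-of-bound : ∀ {c m} → c + suc m ≤ s → c < s
  <-of-bound {c} bound = <-≤-trans (m<m+n c z<s) bound

  suc-bound : ∀ {c m} → c + suc m ≤ s → suc c + m ≤ s
  suc-bound {c} {m} bound = ≤-trans (≤-reflexive (sym (+-suc c m))) bound

  base≤above : ∀ c m → c + suc m ≤ s → All (base c ≤β_) (above c m)
  base≤above c m bound = subst (All (base c ≤β_)) (sym (above-++ c m))
    (All.++⁺ (AllPairs.head (block-chain c (<-of-bound bound))) (base≤blocks m (suc-bound bound)))
    where
    base≤blocks : ∀ m → suc c + m ≤ s → All (base c ≤β_) (blocks (suc c) m)
    base≤blocks zero    _      = []
    base≤blocks (suc m) bound′ = (step ◅ ε) ∷ All.map (step ◅_) (base≤above (suc c) m bound′)
      where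
      step : BetaGen s t (base c) (base (suc c))
      step = spine c (<-≤-trans (m<m+n (suc c) z<s) bound′)

  digit<next : ∀ c {j j′} → j ≤ t → 1 ≤ j′ → j < suc c * t + j′
  digit<next c {j′ = j′} j≤t 1≤j′ = <-≤-trans (≤-<-trans j≤t (m<m+n t 1≤j′)) (+-monoˡ-≤ j′ (m≤m+n t (c * t)))

  digits-injective : ∀ c c′ {j j′} → 1 ≤ j → j ≤ t → 1 ≤ j′ → j′ ≤ t →
                     c * t + j ≡ c′ * t + j′ → c ≡ c′ × j ≡ j′
  digits-injective zero    zero     _   _   _    _    eq = refl , eq
  digits-injective zero    (suc c′) _   j≤t 1≤j′ _    eq = contradiction eq (<⇒≢ (digit<next c′ j≤t 1≤j′))
  digits-injective (suc c) zero     1≤j _   _    j′≤t eq = contradiction (sym eq) (<⇒≢ (digit<next c j′≤t 1≤j))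
  digits-injective (suc c) (suc c′) {j} {j′} 1≤j j≤t 1≤j′ j′≤t eq
    with digits-injective c c′ 1≤j j≤t 1≤j′ j′≤t
           (+-cancelˡ-≡ t _ _ (trans (sym (+-assoc t (c * t) j)) (trans eq (+-assoc t (c′ * t) j′))))
  ... | refl , j≡j′ = refl , j≡j′

  tooth-closed : ∀ {x y} c j → 2 ≤ j → j ≤ t → x ≡ c * t + j → x ≤β y → y ≤ c * t + t
  tooth-closed c j _   j≤t eq   ε = subst (_≤ c * t + t) (sym eq) (+-monoʳ-≤ (c * t) j≤t)
  tooth-closed c j 2≤j j≤t eq   (spine c′ _ ◅ _)
    with digits-injective c′ c ≤-refl (s≤s z≤n) (≤-trans (s≤s z≤n) 2≤j) j≤t eq
  ... | _ , refl with 2≤j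
  ...   | s≤s ()
  tooth-closed c j 2≤j j≤t eq   (tooth c′ j′ _ 1≤j′ j′<t ◅ r)
    with digits-injective c′ c 1≤j′ (≤-trans (n≤1+n j′) j′<t) (≤-trans (s≤s z≤n) 2≤j) j≤t eq
  ... | refl , refl = tooth-closed c (suc j) (≤-trans 2≤j (n≤1+n j)) j′<t refl r

  blockTail↛base-suc : ∀ c → All (λ y → ¬ y ≤β base (suc c)) (blockTail c)
  blockTail↛base-suc c = interval⁺ (c * t) 2 t′ (λ k k<t′ r →
    <⇒≱ (block<base-suc c ≤-refl) (tooth-closed c (2 + k) (s≤s (s≤s z≤n)) (s≤s k<t′) refl r))

  merge : ℕ → Fin t → List ℕ → List ℕ
  merge c i T = take (toℕ i) (blockTail c) ++ base (suc c) ∷ drop (toℕ i) (blockTail c) ++ T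

  extensionTails : ℕ → ℕ → List (List ℕ)
  extensionTails c zero    = blockTail c ∷ []
  extensionTails c (suc m) = cartesianProductWith (merge c) (allFin t) (extensionTails (suc c) m)

  length-extensionTails : ∀ c m → length (extensionTails c m) ≡ t ^ m
  length-extensionTails c zero    = refl
  length-extensionTails c (suc m) =
    trans (length-cartesianProductWith (merge c) (allFin t) (extensionTails (suc c) m))
          (cong₂ _*_ (length-tabulate {n = t} id) (length-extensionTails (suc c) m))

  toℕ≤length-blockTail : ∀ c (i : Fin t) → toℕ i ≤ length (blockTail c)
  toℕ≤length-blockTail c i = subst (toℕ i ≤_) (sym (length-interval (c * t) 2 t′)) (s≤s⁻¹ (toℕ<n i))

  merge-injective : ∀ c {i j T U} → merge c i T ≡ merge c j U → i ≡ j × T ≡ U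
  merge-injective c {i} {j} eq
    with take-∷-injective (blockTail c) (λ b∈ → <-irrefl refl (All.lookup (blockTail<base-suc c) b∈))
                          (toℕ≤length-blockTail c i) (toℕ≤length-blockTail c j) eq
  ... | i≡j , T≡U with toℕ-injective i≡j
  ... | refl = refl , ++-cancelˡ (drop (toℕ i) (blockTail c)) _ _ T≡U

  extensionTails-unique : ∀ c m → Unique (extensionTails c m)
  extensionTails-unique c zero    = [] ∷ []
  extensionTails-unique c (suc m) =
    Unique.cartesianProductWith⁺ (merge c) (merge-injective c) (Unique.allFin⁺ t)
                                 (extensionTails-unique (suc c) m)

  valid-++ : ∀ {xs ys} → AllPairs _<_ xs → xs ≪ ys → Valid ys → Valid (xs ++ ys)
  valid-++ sorted xs≪ys (resp , av) = respectsOrder-++ ≤β⇒≤ sorted xs≪ys resp , avoids231′-++ sorted xs≪ys av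

  valid-++⁻ʳ : ∀ xs {ys} → Valid (xs ++ ys) → Valid ys
  valid-++⁻ʳ xs (resp , av) = AllPairs-++⁻ʳ xs resp , avoids231′-++⁻ʳ xs av

  valid-∷-++⁻ : ∀ {h} B {T} → Valid (h ∷ B ++ T) → Valid (h ∷ T)
  valid-∷-++⁻ B (h↛ ∷ resp , noDrop ∷ av) =
    All.++⁻ʳ B h↛ ∷ AllPairs-++⁻ʳ B resp , AllPairs-++⁻ʳ B noDrop ∷ avoids231′-++⁻ʳ B av

  valid-pivot : ∀ {h B T} → AllPairs _<_ B → All (_< h) B → All (λ b → ¬ b ≤β h) B → All (h <_) T →
                Valid (h ∷ T) → Valid (h ∷ B ++ T)
  valid-pivot sorted B<h B↛h h<T (_ ∷ resp , _ ∷ av) =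
    All.++⁺ B↛h (All.map (λ h<y y≤h → <⇒≱ h<y (≤β⇒≤ y≤h)) h<T) ∷ respectsOrder-++ ≤β⇒≤ sorted B≪T resp ,
    noDropBelow-pivot B<h h≤T ∷ avoids231′-++ sorted B≪T av
    where
    h≤T = All.map <⇒≤ h<T
    B≪T = ≪-separated B<h h≤T

  merge-↭ : ∀ c m i {T} → T ↭ above (suc c) m → merge c i T ↭ above c (suc m)
  merge-↭ c m i {T} T↭ = begin
    take q L ++ h ∷ drop q L ++ T   ↭⟨ ++⁺ˡ (take q L) (↭-sym (shift h (drop q L) T)) ⟩
    take q L ++ drop q L ++ h ∷ T   ≡⟨ ++-assoc (take q L) (drop q L) (h ∷ T) ⟨
    (take q L ++ drop q L) ++ h ∷ T ≡⟨ cong (_++ h ∷ T) (take++drop≡id q L) ⟩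
    L ++ h ∷ T                      ↭⟨ ++⁺ˡ L (prep h T↭) ⟩
    L ++ h ∷ above (suc c) m        ≡⟨ above-++ c (suc m) ⟨
    above c (suc m)                 ∎
    where
    open PermutationReasoning
    q = toℕ i
    L = blockTail c
    h = base (suc c)

  merge-valid : ∀ c m i {T} → T ↭ above (suc c) m → Valid (base (suc c) ∷ T) → Valid (base c ∷ merge c i T)
  merge-valid c m i {T} T↭ valid =
    valid-++ (AllPairs.take⁺ (suc q) block-sorted) prefix≪
      (valid-pivot (AllPairs.drop⁺ q (interval-increasing (c * t) 2 t′)) (All.drop⁺ q (blockTail<base-suc c))
                   (All.drop⁺ q (blockTail↛base-suc c)) h<T valid)
    where
    q = toℕ i
    block-sorted = interval-increasing (c * t) 1 t
    h<T : All (base (suc c) <_) T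
    h<T = All-resp-↭ (↭-sym T↭) (base<above (suc c) m)
    block<h : All (_< base (suc c)) (block c)
    block<h = block<base-suc c (s≤s z≤n) ∷ blockTail<base-suc c
    prefix≪ : take (suc q) (block c) ≪ base (suc c) ∷ drop q (blockTail c) ++ T
    prefix≪ = All.zipWith (λ (x<h , x≪B) → x<h ∷ All.++⁺ x≪B (All.map (<-trans x<h) h<T))
                          (All.take⁺ (suc q) block<h , take≪drop (suc q) block-sorted)

  extensionTails-sound : ∀ c m {T} → T ∈ extensionTails c m → T ↭ above c m × Valid (base c ∷ T)
  extensionTails-sound c zero    (here refl) =
    ↭-reflexive (sym (trans (above-++ c 0) (++-identityʳ (blockTail c)))) ,
    subst Valid (++-identityʳ (block c))
          (valid-++ (interval-increasing (c * t) 1 t) (All.tabulate (λ _ → [])) ([] , []))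
  extensionTails-sound c (suc m) T∈
    with i , T′ , _ , T′∈ , refl ← ∈-cartesianProductWith⁻ (merge c) (allFin t) (extensionTails (suc c) m) T∈
    with T′↭ , valid′ ← extensionTails-sound (suc c) m T′∈
    = merge-↭ c m i T′↭ , merge-valid c m i T′↭ valid′

  blockTail-chain : ∀ c → c < s → AllPairs _≤β_ (blockTail c)
  blockTail-chain c c<s = AllPairs.drop⁺ 1 (block-chain c c<s)

  -- After h, an element above h followed by one below h would form a 231 with h.
  Separated : ℕ → ℕ → ℕ → Set
  Separated h x y = x ≤β y ⊎ (x < h × h < y)

  valid⇒respects-separated : ∀ {h U} → Valid (h ∷ U) → RespectsOrder {R = Separated h} U
  valid⇒respects-separated (_ ∷ resp , noDrop ∷ _) = AllPairs.zipWith unseparated (resp , noDrop)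
    where
    unseparated : ∀ {h x y} → ¬ y ≤β x × (h < x → h ≤ y) → ¬ Separated h y x
    unseparated (y↛x , _)     (inj₁ y≤x)         = y↛x y≤x
    unseparated (_ , noDrop) (inj₂ (y<h , h<x)) = <⇒≱ y<h (noDrop h<x)

  valid-pivot⁻ : ∀ {h B Ys U} → U ↭ B ++ Ys → AllPairs _≤β_ B → All (_< h) B → All (h <_) Ys →
                 Valid (h ∷ U) → ∃ λ T → U ≡ B ++ T × T ↭ Ys × Valid (h ∷ T)
  valid-pivot⁻ {B = B} {U = U} U↭ chain B<h h<Ys valid
    with T , refl , T↭ ← chain-prefix _≟_ B U (valid⇒respects-separated valid) U↭ (AllPairs.map inj₁ chain)
                                     (All.map (λ b<h → All.map (λ h<y → inj₂ (b<h , h<y)) h<Ys) B<h)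
    = T , refl , T↭ , valid-∷-++⁻ B valid

  extensionTails-complete : ∀ c m → c + suc m ≤ s → ∀ {T} → T ↭ above c m → Valid (base c ∷ T) →
                            T ∈ extensionTails c m
  extensionTails-complete c zero bound {T} T↭ (_ ∷ resp , _)
    with T₀ , T≡ , T₀↭[] ← chain-prefix _≟_ (blockTail c) T resp (subst (T ↭_) (above-++ c 0) T↭)
                                       (blockTail-chain c (<-of-bound bound)) (All.tabulate (λ _ → []))
    with refl ← ↭-empty-inv T₀↭[]
    = here (trans T≡ (++-identityʳ (blockTail c)))
  extensionTails-complete c (suc m) bound {T} T↭ valid@(_ ∷ resp , _)
    with q , U , q≤ , refl , U↭ ← pivot-split _≟_ (blockTail c) T resp (subst (T ↭_) (above-++ c (suc m)) T↭)
                                             (blockTail-chain c (<-of-bound bound))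
                                             (base≤above (suc c) m (suc-bound bound))
    with T′ , refl , T′↭ , valid′ ← valid-pivot⁻ U↭ (AllPairs.drop⁺ q (blockTail-chain c (<-of-bound bound)))
                                                 (All.drop⁺ q (blockTail<base-suc c)) (base<above (suc c) m)
                                                 (valid-++⁻ʳ (base c ∷ take q (blockTail c)) valid)
    = let q<t = s≤s (subst (q ≤_) (length-interval (c * t) 2 t′) q≤) in
      subst (_∈ extensionTails c (suc m))
            (cong (λ k → take k (blockTail c) ++ base (suc c) ∷ drop k (blockTail c) ++ T′) (toℕ-fromℕ< q<t))
            (∈-cartesianProductWith⁺ (merge c) (∈-allFin (fromℕ< q<t))
                                     (extensionTails-complete (suc c) m (suc-bound bound) T′↭ valid′))

  extensions : List (List ℕ)
  extensions = map (base 0 ∷_) (extensionTails 0 s′)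

  ∈-extensions⁻ : ∀ {v} → v ∈ extensions → v ↭ base 0 ∷ above 0 s′ × Valid v
  ∈-extensions⁻ v∈ with T , T∈ , refl ← ∈-map⁻ (base 0 ∷_) v∈
                   with T↭ , valid ← extensionTails-sound 0 s′ T∈
                   = prep (base 0) T↭ , valid

  ∈-extensions⁺ : ∀ {v} → v ↭ base 0 ∷ above 0 s′ → Valid v → v ∈ extensions
  ∈-extensions⁺ {v} v↭ valid@(resp , _)
    with T , refl , T↭ ← chain-prefix _≟_ (base 0 ∷ []) v resp v↭ ([] ∷ []) (base≤above 0 s′ ≤-refl ∷ [])
    = ∈-map⁺ (base 0 ∷_) (extensionTails-complete 0 s′ ≤-refl T↭ valid)

theorem10 : ∀ (s t : ℕ) → 1 ≤ s → 1 ≤ t →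
    ∃ λ (L : List (List ℕ)) →
      Unique L ×
      (∀ (v : List ℕ) → (v ∈ L) ⇔ (IsLinearExtension s t v × Avoids231 v)) ×
      (length L ≡ t ^ (s ∸ 1))
theorem10 (suc s′) (suc t′) _ _ =
  extensions ,
  Unique.map⁺ ∷-injectiveʳ (extensionTails-unique 0 s′) ,
  (λ v → mk⇔ (sound v) (complete v)) ,
  trans (length-map (base 0 ∷_) (extensionTails 0 s′)) (length-extensionTails 0 s′)
  where
  open Comb s′ t′
  elements≡ : range1 (s * t) ≡ base 0 ∷ above 0 s′
  elements≡ = range1≡interval (s * t)
  sound : ∀ v → v ∈ extensions → IsLinearExtension s t v × Avoids231 v
  sound v v∈ = let v↭ , resp , av = ∈-extensions⁻ v∈ in
    (subst (v ↭_) (sym elements≡) v↭ , Equivalence.to (respectsOrder⇔lookup v) resp) ,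
    Equivalence.to (avoids231′⇔avoids231 v) av
  complete : ∀ v → IsLinearExtension s t v × Avoids231 v → v ∈ extensions
  complete v ((v↭ , ordered) , avoids) =
    ∈-extensions⁺ (subst (v ↭_) elements≡ v↭)
                  (Equivalence.from (respectsOrder⇔lookup v) ordered ,
                   Equivalence.from (avoids231′⇔avoids231 v) avoids)
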